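{- Every tetrahedron of flowers is line $[B,A]$-nice.
   Context: For $n\in\mathbb N$, a tetrahedron of $n$ flowers is the complete graph $K_4$ on vertices $v,u_1,u_2,u_3$ together with $n$ leaves $x_1,\dots,x_n$ attached to $v$. In the $[B,A]$-edge colouring game with $k$ colours, Bob and Alice alternately colour a previously uncoloured edge with one of $k$ colours so that edges sharing an endpoint get distinct colours; Bob moves first; Alice (only) may skip any of her moves. The game ends when no move is possible; Alice wins iff all edges are coloured. A graph $G$ is line $[B,A]$-nice if the least $k$ for which Alice has a winning strategy equals $\omega(L(G))$, the maximum number of pairwise adjacent edges of $G$. -}

module Defs where

open import Data.Nat using (ℕ; zero; suc; _+_; _<_)
open import Data.Fin using (Fin; zero; suc; _↑ʳ_)
open import Data.Product using (Σ; _×_; _,_; ∃)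
open import Data.Sum using (_⊎_)
open import Data.Maybe using (Maybe; just; nothing)
open import Relation.Binary.PropositionalEquality using (_≡_; _≢_)
open import Relation.Nullary using (¬_)

record Graph : Set where
  field
    V    : ℕ
    m    : ℕ
    ends : Fin m → Fin V × Fin V
open Graph public

ShareEnd : {V : ℕ} → Fin V × Fin V → Fin V × Fin V → Set
ShareEnd (a , b) (c , d) = (a ≡ c ⊎ a ≡ d) ⊎ (b ≡ c ⊎ b ≡ d)

-- adjacency in the line graph L(G): distinct edges sharing an endpoint
EdgeAdj : (G : Graph) → Fin (m G) → Fin (m G) → Set
EdgeAdj G e f = e ≢ f × ShareEnd (ends G e) (ends G f)

LineClique : Graph → ℕ → Set
LineClique G s = Σ (Fin s → Fin (m G)) λ f → ∀ i j → i ≢ j → EdgeAdj G (f i) (f j)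

IsLineCliqueNumber : Graph → ℕ → Set
IsLineCliqueNumber G w = LineClique G w × (∀ s → LineClique G s → s Data.Nat.≤ w)

-- a partial edge colouring (nothing = uncoloured)
Colouring : Graph → ℕ → Set
Colouring G k = Fin (m G) → Maybe (Fin k)

empty : (G : Graph) (k : ℕ) → Colouring G k
empty G k e = nothing

Legal : (G : Graph) {k : ℕ} → Colouring G k → Fin (m G) → Fin k → Set
Legal G c e a = (c e ≡ nothing) × (∀ f → EdgeAdj G e f → c f ≢ just a)

update : (G : Graph) {k : ℕ} → Colouring G k → Fin (m G) → Fin k → Colouring G k
update G c e a f with e Data.Fin.≟ f
... | Relation.Nullary.yes _ = just a
... | Relation.Nullary.no  _ = c f

Stuck : (G : Graph) {k : ℕ} → Colouring G k → Set
Stuck G c = ∀ e a → ¬ Legal G c e a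

AllColoured : (G : Graph) {k : ℕ} → Colouring G k → Set
AllColoured G c = ∀ e → c e ≢ nothing

-- Alice has a winning strategy from position c, with Bob / Alice to move.
mutual
  data WinB (G : Graph) {k : ℕ} (c : Colouring G k) : Set where
    endB  : Stuck G c → AllColoured G c → WinB G c
    moveB : ¬ Stuck G c →
            (∀ e a → Legal G c e a → WinA G (update G c e a)) → WinB G c

  data WinA (G : Graph) {k : ℕ} (c : Colouring G k) : Set where
    endA  : Stuck G c → AllColoured G c → WinA G c
    skipA : ¬ Stuck G c → WinB G c → WinA G c
    moveA : ∀ e a → Legal G c e a → WinB G (update G c e a) → WinA G c

AliceWins : Graph → ℕ → Set
AliceWins G k = WinB G {k} (empty G k)

IsGameChromaticIndexBA : Graph → ℕ → Set
IsGameChromaticIndexBA G k = AliceWins G k × (∀ j → j < k → ¬ AliceWins G j)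

LineNiceBA : Graph → Set
LineNiceBA G = ∃ λ w → IsLineCliqueNumber G w × IsGameChromaticIndexBA G w

-- Tetrahedron of n flowers: vertices v = 0, u1,u2,u3 = 1,2,3, x_i = 4+i;
-- edges: the six edges of K4 on {0,1,2,3}, then edges v x_i.
tetraEnds : (n : ℕ) → Fin (6 + n) → Fin (4 + n) × Fin (4 + n)
tetraEnds n zero = zero , suc zero
tetraEnds n (suc zero) = zero , suc (suc zero)
tetraEnds n (suc (suc zero)) = zero , suc (suc (suc zero))
tetraEnds n (suc (suc (suc zero))) = suc zero , suc (suc zero)
tetraEnds n (suc (suc (suc (suc zero)))) = suc zero , suc (suc (suc zero))
tetraEnds n (suc (suc (suc (suc (suc zero))))) = suc (suc zero) , suc (suc (suc zero))
tetraEnds n (suc (suc (suc (suc (suc (suc i)))))) = zero , 4 ↑ʳ i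

tetrahedronOfFlowers : ℕ → Graph
tetrahedronOfFlowers n = record { V = 4 + n ; m = 6 + n ; ends = tetraEnds n }

-- ω(L(G)) = n + 3: the n + 3 edges at v are pairwise adjacent, and colouring each of them differently
-- and each edge of the triangle u₁u₂u₃ like the edge at v disjoint from it is proper. With fewer colours
-- Alice loses because a finished game is a proper total colouring. With n + 3 colours Alice pairs each
-- edge v uᵢ with its disjoint triangle edge (its mate) and keeps two invariants: mates are coloured
-- together, and every colour in use appears at v. If Bob colours v uᵢ she copies the colour onto its
-- mate, whose neighbours are all neighbours of v uᵢ. If Bob colours the mate of v uᵢ, she colours v uᵢ
-- with the same colour if it is missing at v, and with some colour missing at v otherwise. After a leaf
-- move she passes. While some edge is uncoloured some edge at v is, so some colour is missing at v,
-- hence everywhere, and the game cannot get stuck.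

module Submission where

open import Data.Bool using (true; false)
open import Data.Empty using (⊥)
open import Data.Fin using (Fin; zero; suc; _≟_; _↑ˡ_; _↑ʳ_; punchOut)
open import Data.Fin.Properties
  using (any?; all?; ¬∀⟶∃¬; suc-injective; ↑ˡ-injective; punchOut-injective;
         injective⇒≤; <⇒notInjective)
open import Data.Maybe using (Maybe; just; nothing; is-just)
open import Data.Maybe.Properties using (just-injective) renaming (≡-dec to ≡-dec-Maybe)
open import Data.Nat using (ℕ; zero; suc; _+_; _≤_; _<_)
open import Data.Nat.Properties using (≤-refl; ≤-pred; <-trans; <-≤-trans; n<1+n; +-monoʳ-<; <⇒≱)
open import Data.Product using (_×_; _,_; ∃; proj₁; proj₂)
open import Data.Sum using (_⊎_; inj₁; inj₂; map₂)
open import Function using (_∘_)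
open import Relation.Nullary using (¬_; Dec; yes; no; contradiction)
open import Relation.Nullary.Decidable using (¬?; _×-dec_; _⊎-dec_; from-yes; decidable-stable)
open import Relation.Binary.PropositionalEquality using (_≡_; _≢_; refl; sym; trans; cong; subst)

open import Defs

is-just≡false : ∀ {A : Set} {x : Maybe A} → is-just x ≡ false → x ≡ nothing
is-just≡false {x = nothing} _ = refl

≢nothing⇒just : ∀ {A : Set} {x : Maybe A} → x ≢ nothing → ∃ λ a → x ≡ just a
≢nothing⇒just {x = just a} _ = a , refl
≢nothing⇒just {x = nothing} x≢nothing = contradiction refl x≢nothing

Extends : (G : Graph) {k : ℕ} → Colouring G k → Colouring G k → Set
Extends G c c′ = ∀ f b → c f ≡ just b → c′ f ≡ just b

module _ {G : Graph} {k : ℕ} where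

  update-here : ∀ (c : Colouring G k) e a → update G c e a e ≡ just a
  update-here c e a with e ≟ e
  ... | yes _ = refl
  ... | no e≢e = contradiction refl e≢e

  update-elsewhere : ∀ (c : Colouring G k) {e f} a → e ≢ f → update G c e a f ≡ c f
  update-elsewhere c {e} {f} a e≢f with e ≟ f
  ... | yes e≡f = contradiction e≡f e≢f
  ... | no _ = refl

  update-new : ∀ (c : Colouring G k) e a {f b} → update G c e a f ≡ just b → c f ≡ just b ⊎ b ≡ a
  update-new c e a {f} h with e ≟ f
  ... | yes _ = inj₂ (sym (just-injective h))
  ... | no _ = inj₁ h

  update₂-elsewhere : ∀ (c : Colouring G k) e a e′ b {f} → e ≢ f → e′ ≢ f →
                      update G (update G c e a) e′ b f ≡ c f
  update₂-elsewhere c e a e′ b e≢f e′≢f =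
    trans (update-elsewhere _ b e′≢f) (update-elsewhere c a e≢f)

  update₂-coloured : ∀ (c : Colouring G k) e a e′ b {f} → f ≡ e ⊎ f ≡ e′ →
                     is-just (update G (update G c e a) e′ b f) ≡ true
  update₂-coloured c e a e′ b {f} f∈ with e′ ≟ f | f∈
  ... | yes _ | _ = refl
  ... | no _ | inj₁ refl = cong is-just (update-here c e a)
  ... | no e′≢f | inj₂ refl = contradiction refl e′≢f

  update-extends : ∀ (c : Colouring G k) {e} a → c e ≡ nothing → Extends G c (update G c e a)
  update-extends c {e} a ce f b cf with e ≟ f
  ... | yes refl = contradiction (trans (sym ce) cf) λ ()
  ... | no _ = cf

  coloured-or-gap : ∀ (c : Colouring G k) → AllColoured G c ⊎ ∃ λ e → c e ≡ nothing
  coloured-or-gap c with any? (λ e → ≡-dec-Maybe _≟_ (c e) nothing)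
  ... | yes gap = inj₂ gap
  ... | no no-gap = inj₁ λ e ce → no-gap (e , ce)

  all-coloured-stuck : ∀ {c : Colouring G k} → AllColoured G c → Stuck G c
  all-coloured-stuck all e a (ce , _) = all e ce

  unused-legal : ∀ {c : Colouring G k} {e a} → c e ≡ nothing → (∀ f → c f ≢ just a) →
                 Legal G c e a
  unused-legal ce unused = ce , λ f _ → unused f

  legal-update : ∀ {c : Colouring G k} {e e′ a b} → Legal G c e′ b → e ≢ e′ →
                 (EdgeAdj G e′ e → a ≢ b) → Legal G (update G c e a) e′ b
  legal-update {c} {e} {e′} {a} {b} (ce′ , free) e≢e′ clash =
    trans (update-elsewhere c a e≢e′) ce′ , new-free
    where
    new-free : ∀ f → EdgeAdj G e′ f → update G c e a f ≢ just b
    new-free f adj with e ≟ f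
    ... | yes refl = clash adj ∘ just-injective
    ... | no _ = free f adj

gap-count : {A : Set} → Maybe A → ℕ
gap-count nothing = 1
gap-count (just _) = 0

uncoloured : ∀ {m} {A : Set} → (Fin m → Maybe A) → ℕ
uncoloured {zero} c = 0
uncoloured {suc m} c = gap-count (c zero) + uncoloured (c ∘ suc)

uncoloured-cong : ∀ {m} {A : Set} (c d : Fin m → Maybe A) → (∀ f → d f ≡ c f) →
                  uncoloured d ≡ uncoloured c
uncoloured-cong {zero} c d d≗c = refl
uncoloured-cong {suc m} c d d≗c
  rewrite d≗c zero | uncoloured-cong (c ∘ suc) (d ∘ suc) (d≗c ∘ suc) = refl

uncoloured-< : ∀ {m} {A : Set} (c d : Fin m → Maybe A) {e a} → c e ≡ nothing → d e ≡ just a →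
               (∀ f → e ≢ f → d f ≡ c f) → uncoloured d < uncoloured c
uncoloured-< c d {zero} ce de agree
  rewrite ce | de | uncoloured-cong (c ∘ suc) (d ∘ suc) (λ f → agree (suc f) λ ()) = n<1+n _
uncoloured-< c d {suc e} ce de agree
  rewrite agree zero (λ ()) =
  +-monoʳ-< (gap-count (c zero))
            (uncoloured-< (c ∘ suc) (d ∘ suc) ce de (λ f e≢f → agree (suc f) (e≢f ∘ suc-injective)))

uncoloured-update : ∀ {G k} (c : Colouring G k) {e} a → c e ≡ nothing →
                    uncoloured (update G c e a) < uncoloured c
uncoloured-update {G} c {e} a ce =
  uncoloured-< c (update G c e a) ce (update-here c e a) (λ f → update-elsewhere c a)

missing-colour : ∀ {k} (h : Fin k → Maybe (Fin k)) r₀ → h r₀ ≡ nothing →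
                 ∃ λ a → ∀ r → h r ≢ just a
missing-colour {suc k} h r₀ hr₀ with any? (λ a → all? (λ r → ¬? (≡-dec-Maybe _≟_ (h r) (just a))))
... | yes missing = missing
-- Otherwise, a slot showing each colour would inject the k colours into the k - 1 other slots.
... | no ¬missing = contradiction (λ {a} {b} → avoid-injective {a} {b}) (<⇒notInjective ≤-refl)
  where
  source : ∀ a → ∃ λ r → h r ≡ just a
  source a =
    let r , ¬¬hit = ¬∀⟶∃¬ _ _ (λ r → ¬? (≡-dec-Maybe _≟_ (h r) (just a))) (¬missing ∘ (a ,_))
    in r , decidable-stable (≡-dec-Maybe _≟_ (h r) (just a)) ¬¬hit
  source≢r₀ : ∀ a → r₀ ≢ proj₁ (source a)
  source≢r₀ a eq = contradiction (trans (sym hr₀) (trans (cong h eq) (proj₂ (source a)))) λ ()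
  avoid : Fin (suc k) → Fin k
  avoid a = punchOut (source≢r₀ a)
  avoid-injective : ∀ {a b} → avoid a ≡ avoid b → a ≡ b
  avoid-injective {a} {b} eq = just-injective (trans (sym (proj₂ (source a)))
    (trans (cong h (punchOut-injective (source≢r₀ a) (source≢r₀ b) eq)) (proj₂ (source b))))

ShareEnd-sym : ∀ {V} (x y : Fin V × Fin V) → ShareEnd x y → ShareEnd y x
ShareEnd-sym _ _ (inj₁ (inj₁ refl)) = inj₁ (inj₁ refl)
ShareEnd-sym _ _ (inj₁ (inj₂ refl)) = inj₂ (inj₁ refl)
ShareEnd-sym _ _ (inj₂ (inj₁ refl)) = inj₁ (inj₂ refl)
ShareEnd-sym _ _ (inj₂ (inj₂ refl)) = inj₂ (inj₂ refl)

module _ (G : Graph) where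

  EdgeAdj-sym : ∀ {e f} → EdgeAdj G e f → EdgeAdj G f e
  EdgeAdj-sym {e} {f} (e≢f , share) = e≢f ∘ sym , ShareEnd-sym (ends G e) (ends G f) share

  EdgeAdj? : ∀ e f → Dec (EdgeAdj G e f)
  EdgeAdj? e f = ¬? (e ≟ f) ×-dec shareEnd? (ends G e) (ends G f)
    where
    shareEnd? : (x y : Fin (V G) × Fin (V G)) → Dec (ShareEnd x y)
    shareEnd? (a , b) (c , d) = (a ≟ c ⊎-dec a ≟ d) ⊎-dec (b ≟ c ⊎-dec b ≟ d)

  clique≤colours : ∀ {s w} → LineClique G s → (φ : Fin (m G) → Fin w) →
                   (∀ e f → EdgeAdj G e f → φ e ≢ φ f) → s ≤ w
  clique≤colours (clique , adjacent) φ proper = injective⇒≤ φ∘clique-injective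
    where
    φ∘clique-injective : ∀ {i j} → φ (clique i) ≡ φ (clique j) → i ≡ j
    φ∘clique-injective {i} {j} eq with i ≟ j
    ... | yes i≡j = i≡j
    ... | no i≢j = contradiction eq (proper _ _ (adjacent i j i≢j))

-- Fewer colours than a line clique

module _ {G : Graph} {k : ℕ} where

  Proper : Colouring G k → Set
  Proper c = ∀ e f a → EdgeAdj G e f → c e ≡ just a → c f ≢ just a

  proper-update : ∀ {c e a} → Proper c → Legal G c e a → Proper (update G c e a)
  proper-update {c} {e} {a} proper (_ , free) x y b adj cx cy with e ≟ x | e ≟ y
  ... | yes refl | yes refl = proj₁ adj refl
  ... | yes refl | no _ = free y adj (trans cy (sym cx))
  ... | no _ | yes refl = free x (EdgeAdj-sym G adj) (trans cx (sym cy))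
  ... | no _ | no _ = proper x y b adj cx cy

  module _ {s} (clique : LineClique G s) (k<s : k < s) where

    no-proper-total : ∀ {c} → Proper c → AllColoured G c → ⊥
    no-proper-total {c} proper all = <⇒≱ k<s (clique≤colours G clique (proj₁ ∘ colour) distinct)
      where
      colour : ∀ e → ∃ λ a → c e ≡ just a
      colour e = ≢nothing⇒just (all e)
      distinct : ∀ e f → EdgeAdj G e f → proj₁ (colour e) ≢ proj₁ (colour f)
      distinct e f adj eq =
        proper e f _ adj (proj₂ (colour e)) (trans (proj₂ (colour f)) (cong just (sym eq)))

    ¬WinB-proper : ∀ {c} → Proper c → ¬ WinB G c
    ¬WinA-proper : ∀ {c} → Proper c → ¬ WinA G c

    ¬WinB-proper proper (endB _ all) = no-proper-total proper all
    ¬WinB-proper proper (moveB not-stuck win) =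
      not-stuck λ e a legal → ¬WinA-proper (proper-update proper legal) (win e a legal)

    ¬WinA-proper proper (endA _ all) = no-proper-total proper all
    ¬WinA-proper proper (skipA _ win) = ¬WinB-proper proper win
    ¬WinA-proper proper (moveA e a legal win) = ¬WinB-proper (proper-update proper legal) win

    alice-loses-below-clique : ¬ AliceWins G k
    alice-loses-below-clique = ¬WinB-proper (λ _ _ _ _ ())

-- Winning by an invariant

module _ (G : Graph) {k : ℕ} (Invariant : Colouring G k → Set) where

  data Reply (c : Colouring G k) : Set where
    pass   : Invariant c → Reply c
    answer : ∀ e a → Legal G c e a → Invariant (update G c e a) → Reply c

  module _ (start : Invariant (empty G k))
           (unstuck : ∀ {c e} → Invariant c → c e ≡ nothing → ¬ Stuck G c)
           (reply : ∀ {c e a} → Invariant c → Legal G c e a → Reply (update G c e a)) where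

    win-from : ∀ N {c} → uncoloured c < N → Invariant c → WinB G c
    win-after-bob : ∀ N {c} → uncoloured c < N → Reply c → WinA G c

    win-from zero () _
    win-from (suc N) {c} bound inv with coloured-or-gap {G} c
    ... | inj₁ all = endB (all-coloured-stuck all) all
    ... | inj₂ (_ , ce) = moveB (unstuck inv ce) λ e a legal →
      win-after-bob N (<-≤-trans (uncoloured-update c a (proj₁ legal)) (≤-pred bound)) (reply inv legal)

    win-after-bob N {c} bound (pass inv) with coloured-or-gap {G} c
    ... | inj₁ all = endA (all-coloured-stuck all) all
    ... | inj₂ (_ , ce) = skipA (unstuck inv ce) (win-from N bound inv)
    win-after-bob N {c} bound (answer e a legal inv) =
      moveA e a legal (win-from N (<-trans (uncoloured-update c a (proj₁ legal)) bound) inv)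

    alice-wins-by-invariant : AliceWins G k
    alice-wins-by-invariant = win-from _ (n<1+n _) start

-- The tetrahedron of flowers

module Tetrahedron (n : ℕ) where

  T : Graph
  T = tetrahedronOfFlowers n

  Edge : Set
  Edge = Fin (6 + n)

  star : Fin (3 + n) → Edge
  star zero = zero
  star (suc zero) = suc zero
  star (suc (suc zero)) = suc (suc zero)
  star (suc (suc (suc i))) = 6 ↑ʳ i

  vu : Fin 3 → Edge
  vu p = star (p ↑ˡ n)

  -- the edge of the triangle u₁u₂u₃ disjoint from vu p
  opp : Fin 3 → Edge
  opp zero = suc (suc (suc (suc (suc zero))))
  opp (suc zero) = suc (suc (suc (suc zero)))
  opp (suc (suc zero)) = suc (suc (suc zero))

  mates-distinct : ∀ p → vu p ≢ opp p
  mates-distinct = from-yes (all? λ p → ¬? (vu p ≟ opp p))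

  mates-disjoint : ∀ p → ¬ EdgeAdj T (vu p) (opp p)
  mates-disjoint = from-yes (all? λ p → ¬? (EdgeAdj? T (vu p) (opp p)))

  vu-adj-opp : ∀ p q → p ≡ q ⊎ EdgeAdj T (vu p) (opp q)
  vu-adj-opp = from-yes (all? λ p → all? λ q → p ≟ q ⊎-dec EdgeAdj? T (vu p) (opp q))

  opp-adj-opp : ∀ p q → p ≡ q ⊎ EdgeAdj T (opp p) (opp q)
  opp-adj-opp = from-yes (all? λ p → all? λ q → p ≟ q ⊎-dec EdgeAdj? T (opp p) (opp q))

  -- a proper edge colouring in which opp p gets the colour of vu p
  class : Edge → Fin (3 + n)
  class zero = zero
  class (suc zero) = suc zero
  class (suc (suc zero)) = suc (suc zero)
  class (suc (suc (suc zero))) = suc (suc zero)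
  class (suc (suc (suc (suc zero)))) = suc zero
  class (suc (suc (suc (suc (suc zero))))) = zero
  class (suc (suc (suc (suc (suc (suc i)))))) = 3 ↑ʳ i

  star-class : ∀ r → class (star r) ≡ r
  star-class zero = refl
  star-class (suc zero) = refl
  star-class (suc (suc zero)) = refl
  star-class (suc (suc (suc i))) = refl

  opp-class : ∀ p → class (opp p) ≡ p ↑ˡ n
  opp-class zero = refl
  opp-class (suc zero) = refl
  opp-class (suc (suc zero)) = refl

  star-at-v : ∀ r → proj₁ (ends T (star r)) ≡ zero
  star-at-v zero = refl
  star-at-v (suc zero) = refl
  star-at-v (suc (suc zero)) = refl
  star-at-v (suc (suc (suc i))) = refl

  star-injective : ∀ {r s} → star r ≡ star s → r ≡ s
  star-injective {r} {s} eq = trans (sym (star-class r)) (trans (cong class eq) (star-class s))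

  star-clique : LineClique T (3 + n)
  star-clique = star , λ r s r≢s →
    r≢s ∘ star-injective , inj₁ (inj₁ (trans (star-at-v r) (sym (star-at-v s))))

  data Shape : Edge → Set where
    at-v     : ∀ r → Shape (star r)
    opposite : ∀ p → Shape (opp p)

  shape : ∀ e → Shape e
  shape zero = at-v zero
  shape (suc zero) = at-v (suc zero)
  shape (suc (suc zero)) = at-v (suc (suc zero))
  shape (suc (suc (suc zero))) = opposite (suc (suc zero))
  shape (suc (suc (suc (suc zero)))) = opposite (suc zero)
  shape (suc (suc (suc (suc (suc zero))))) = opposite zero
  shape (suc (suc (suc (suc (suc (suc i)))))) = at-v (3 ↑ʳ i)

  class-star≡class-opp : ∀ r p → class (star r) ≡ class (opp p) → star r ≡ vu p
  class-star≡class-opp r p eq = cong star (trans (sym (star-class r)) (trans eq (opp-class p)))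

  class-proper : ∀ e f → EdgeAdj T e f → class e ≢ class f
  class-proper e f adj eq with shape e | shape f
  ... | at-v r | at-v s =
    proj₁ adj (cong star (trans (sym (star-class r)) (trans eq (star-class s))))
  ... | opposite p | opposite q =
    proj₁ adj (cong opp (↑ˡ-injective n p q (trans (sym (opp-class p)) (trans eq (opp-class q)))))
  ... | at-v r | opposite q =
    mates-disjoint q (subst (λ e → EdgeAdj T e (opp q)) (class-star≡class-opp r q eq) adj)
  ... | opposite p | at-v s =
    mates-disjoint p
      (subst (λ e → EdgeAdj T e (opp p)) (class-star≡class-opp s p (sym eq)) (EdgeAdj-sym T adj))

  opp-adj⇒vu-adj : ∀ p {f} → EdgeAdj T (opp p) f → EdgeAdj T (vu p) f
  opp-adj⇒vu-adj p {f} adj with shape f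
  ... | at-v r with r ≟ p ↑ˡ n
  ...   | yes refl = contradiction (EdgeAdj-sym T adj) (mates-disjoint p)
  ...   | no r≢p = proj₂ star-clique (p ↑ˡ n) r (r≢p ∘ sym)
  opp-adj⇒vu-adj p {f} adj | opposite q with vu-adj-opp p q
  ...   | inj₁ refl = contradiction refl (proj₁ adj)
  ...   | inj₂ adj′ = adj′

  vu-adj⇒star⊎opp-adj : ∀ p {f} → EdgeAdj T (vu p) f →
                        (∃ λ r → f ≡ star r) ⊎ EdgeAdj T (opp p) f
  vu-adj⇒star⊎opp-adj p {f} adj with shape f
  ... | at-v r = inj₁ (r , refl)
  ... | opposite q with opp-adj-opp p q
  ...   | inj₁ refl = contradiction adj (mates-disjoint p)
  ...   | inj₂ adj′ = inj₂ adj′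

  Col : Set
  Col = Colouring T (3 + n)

  SeenAtV : Col → Fin (3 + n) → Set
  SeenAtV c b = ∃ λ r → c (star r) ≡ just b

  AllSeenAtV : Col → Set
  AllSeenAtV c = ∀ f b → c f ≡ just b → SeenAtV c b

  MatesAgree : Col → Set
  MatesAgree c = ∀ p → is-just (c (vu p)) ≡ is-just (c (opp p))

  record Invariant (c : Col) : Set where
    field
      mates-agree : MatesAgree c
      all-seen    : AllSeenAtV c
  open Invariant

  seen-extends : ∀ {c c′ b} → Extends T c c′ → SeenAtV c b → SeenAtV c′ b
  seen-extends ext (r , seen) = r , ext (star r) _ seen

  unseen-unused : ∀ {c a} → AllSeenAtV c → (∀ r → c (star r) ≢ just a) → ∀ f → c f ≢ just a
  unseen-unused all-seen unseen f cf = let r , seen = all-seen f _ cf in unseen r seen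

  all-seen-extend : ∀ {c c′} → AllSeenAtV c → Extends T c c′ →
                    (∀ f b → c′ f ≡ just b → c f ≡ just b ⊎ SeenAtV c′ b) → AllSeenAtV c′
  all-seen-extend all-seen ext new f b c′f with new f b c′f
  ... | inj₁ cf = seen-extends ext (all-seen f b cf)
  ... | inj₂ seen = seen

  all-seen-update : ∀ {c e a} → AllSeenAtV c → c e ≡ nothing →
                    SeenAtV (update T c e a) a → AllSeenAtV (update T c e a)
  all-seen-update {c} {e} {a} all-seen ce seen =
    all-seen-extend all-seen (update-extends c a ce)
                    λ f b h → map₂ (λ { refl → seen }) (update-new c e a h)

  all-seen-update₂ : ∀ {c e e′ a b} → AllSeenAtV c → c e ≡ nothing → c e′ ≡ nothing → e ≢ e′ →
                     let c₂ = update T (update T c e a) e′ b in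
                     SeenAtV c₂ a → SeenAtV c₂ b → AllSeenAtV c₂
  all-seen-update₂ {c} {e} {e′} {a} {b} all-seen ce ce′ e≢e′ seen-a seen-b =
    all-seen-extend all-seen (λ f x → update-extends c₁ b c₁e′ f x ∘ update-extends c a ce f x) new
    where
    c₁ : Col
    c₁ = update T c e a
    c₁e′ : c₁ e′ ≡ nothing
    c₁e′ = trans (update-elsewhere c a e≢e′) ce′
    new : ∀ f x → update T c₁ e′ b f ≡ just x → c f ≡ just x ⊎ SeenAtV (update T c₁ e′ b) x
    new f x h with update-new c₁ e′ b h
    ... | inj₂ refl = inj₂ seen-b
    ... | inj₁ c₁f with update-new c e a c₁f
    ...   | inj₁ cf = inj₁ cf
    ...   | inj₂ refl = inj₂ seen-a

  opp-gap : ∀ {c} p → MatesAgree c → c (vu p) ≡ nothing → c (opp p) ≡ nothing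
  opp-gap p agree gap = is-just≡false (trans (sym (agree p)) (cong is-just gap))

  vu-gap : ∀ {c} p → MatesAgree c → c (opp p) ≡ nothing → c (vu p) ≡ nothing
  vu-gap p agree gap = is-just≡false (trans (agree p) (cong is-just gap))

  gap-at-v : ∀ {c e} → MatesAgree c → c e ≡ nothing → ∃ λ r → c (star r) ≡ nothing
  gap-at-v {c} {e} agree gap with shape e
  ... | at-v r = r , gap
  ... | opposite p = p ↑ˡ n , vu-gap {c} p agree gap

  mates-frame : ∀ {c c′} r → MatesAgree c → (∀ f → class f ≢ r → c′ f ≡ c f) →
                (∀ p → p ↑ˡ n ≡ r → is-just (c′ (vu p)) ≡ is-just (c′ (opp p))) → MatesAgree c′
  mates-frame r agree frame touched q with q ↑ˡ n ≟ r
  ... | yes q∈r = touched q q∈r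
  ... | no q∉r = trans (cong is-just (frame (vu q) (q∉r ∘ trans (sym (star-class (q ↑ˡ n))))))
                   (trans (agree q) (sym (cong is-just (frame (opp q) (q∉r ∘ trans (sym (opp-class q)))))))

  data Mates (p : Fin 3) : Edge → Edge → Set where
    vu-first  : Mates p (vu p) (opp p)
    opp-first : Mates p (opp p) (vu p)

  mates-class : ∀ {p e e′} → Mates p e e′ → class e ≡ p ↑ˡ n × class e′ ≡ p ↑ˡ n
  mates-class {p} vu-first = star-class (p ↑ˡ n) , opp-class p
  mates-class {p} opp-first = opp-class p , star-class (p ↑ˡ n)

  mates-≢ : ∀ {p e e′} → Mates p e e′ → e ≢ e′
  mates-≢ {p} vu-first = mates-distinct p
  mates-≢ {p} opp-first = mates-distinct p ∘ sym

  mates-coloured : ∀ {p e e′} (c : Col) a b → Mates p e e′ →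
                   let c₂ = update T (update T c e a) e′ b in is-just (c₂ (vu p)) ≡ is-just (c₂ (opp p))
  mates-coloured {p} c a b vu-first =
    trans (update₂-coloured c (vu p) a (opp p) b (inj₁ refl))
          (sym (update₂-coloured c (vu p) a (opp p) b (inj₂ refl)))
  mates-coloured {p} c a b opp-first =
    trans (update₂-coloured c (opp p) a (vu p) b (inj₂ refl))
          (sym (update₂-coloured c (opp p) a (vu p) b (inj₁ refl)))

  invariant-pair : ∀ {p e e′ c a b} → Mates p e e′ → Invariant c → c e ≡ nothing → c e′ ≡ nothing →
                   let c₂ = update T (update T c e a) e′ b in
                   SeenAtV c₂ a → SeenAtV c₂ b → Invariant c₂
  invariant-pair {p} {e} {e′} {c} {a} {b} mates inv ce ce′ seen-a seen-b = record
    { mates-agree = mates-frame (p ↑ˡ n) (mates-agree inv) frame touched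
    ; all-seen = all-seen-update₂ (all-seen inv) ce ce′ (mates-≢ mates) seen-a seen-b
    }
    where
    c₂ : Col
    c₂ = update T (update T c e a) e′ b
    apart : ∀ {x f} → class x ≡ p ↑ˡ n → class f ≢ p ↑ˡ n → x ≢ f
    apart x∈p f∉p refl = f∉p x∈p
    frame : ∀ f → class f ≢ p ↑ˡ n → c₂ f ≡ c f
    frame f f∉p = update₂-elsewhere c e a e′ b (apart (proj₁ (mates-class mates)) f∉p)
                                                (apart (proj₂ (mates-class mates)) f∉p)
    touched : ∀ q → q ↑ˡ n ≡ p ↑ˡ n → is-just (c₂ (vu q)) ≡ is-just (c₂ (opp q))
    touched q q≡p with ↑ˡ-injective n q p q≡p
    ... | refl = mates-coloured c a b mates

  invariant-empty : Invariant (empty T (3 + n))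
  invariant-empty = record { mates-agree = λ _ → refl ; all-seen = λ _ _ () }

  unstuck : ∀ {c e} → Invariant c → c e ≡ nothing → ¬ Stuck T c
  unstuck {c} inv gap stuck =
    let r , star-gap = gap-at-v {c} (mates-agree inv) gap
        a , unseen = missing-colour (c ∘ star) r star-gap
    in stuck _ a (unused-legal gap (unseen-unused (all-seen inv) unseen))

  reply-vu : ∀ {c p a} → Invariant c → Legal T c (vu p) a → Reply T Invariant (update T c (vu p) a)
  reply-vu {c} {p} {a} inv (gap , free) =
    answer (opp p) a legal (invariant-pair vu-first inv gap mate-gap seen seen)
    where
    mate-gap : c (opp p) ≡ nothing
    mate-gap = opp-gap {c} p (mates-agree inv) gap
    legal : Legal T (update T c (vu p) a) (opp p) a
    legal = legal-update (mate-gap , λ f adj → free f (opp-adj⇒vu-adj p adj))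
                         (mates-distinct p) (λ adj _ → mates-disjoint p (EdgeAdj-sym T adj))
    seen : SeenAtV (update T (update T c (vu p) a) (opp p) a) a
    seen = p ↑ˡ n , trans (update-elsewhere _ a (mates-distinct p ∘ sym)) (update-here c (vu p) a)

  module _ {c p a} (inv : Invariant c) (legal : Legal T c (opp p) a) where

    private
      mate-gap : c (vu p) ≡ nothing
      mate-gap = vu-gap {c} p (mates-agree inv) (proj₁ legal)

    reply-opp-unseen : ¬ SeenAtV c a → Reply T Invariant (update T c (opp p) a)
    reply-opp-unseen unseen =
      answer (vu p) a legal′ (invariant-pair opp-first inv (proj₁ legal) mate-gap seen seen)
      where
      free-at-vu : ∀ f → EdgeAdj T (vu p) f → c f ≢ just a
      free-at-vu f adj with vu-adj⇒star⊎opp-adj p adj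
      ... | inj₁ (r , refl) = unseen ∘ (r ,_)
      ... | inj₂ adj′ = proj₂ legal f adj′
      legal′ : Legal T (update T c (opp p) a) (vu p) a
      legal′ = legal-update (mate-gap , free-at-vu) (mates-distinct p ∘ sym)
                            (λ adj _ → mates-disjoint p adj)
      seen : SeenAtV (update T (update T c (opp p) a) (vu p) a) a
      seen = p ↑ˡ n , update-here _ (vu p) a

    reply-opp-seen : SeenAtV c a → Reply T Invariant (update T c (opp p) a)
    reply-opp-seen seen =
      answer (vu p) a′ legal′ (invariant-pair opp-first inv (proj₁ legal) mate-gap seen₂ seen₂′)
      where
      c₁ : Col
      c₁ = update T c (opp p) a
      c₁-gap : c₁ (vu p) ≡ nothing
      c₁-gap = trans (update-elsewhere c a (mates-distinct p ∘ sym)) mate-gap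
      seen₁ : SeenAtV c₁ a
      seen₁ = seen-extends (update-extends c a (proj₁ legal)) seen
      missing : ∃ λ a′ → ∀ r → c₁ (star r) ≢ just a′
      missing = missing-colour (c₁ ∘ star) (p ↑ˡ n) c₁-gap
      a′ : Fin (3 + n)
      a′ = proj₁ missing
      legal′ : Legal T c₁ (vu p) a′
      legal′ = unused-legal c₁-gap
                 (unseen-unused (all-seen-update (all-seen inv) (proj₁ legal) seen₁) (proj₂ missing))
      seen₂ : SeenAtV (update T c₁ (vu p) a′) a
      seen₂ = seen-extends (update-extends c₁ a′ c₁-gap) seen₁
      seen₂′ : SeenAtV (update T c₁ (vu p) a′) a′
      seen₂′ = p ↑ˡ n , update-here c₁ (vu p) a′

    reply-opp : Reply T Invariant (update T c (opp p) a)
    reply-opp with any? (λ r → ≡-dec-Maybe _≟_ (c (star r)) (just a))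
    ... | yes seen = reply-opp-seen seen
    ... | no unseen = reply-opp-unseen unseen

  reply-leaf : ∀ {c r a} → Invariant c → (∀ p → p ↑ˡ n ≢ r) → Legal T c (star r) a →
               Reply T Invariant (update T c (star r) a)
  reply-leaf {c} {r} {a} inv leaf (gap , _) = pass record
    { mates-agree = mates-frame r (mates-agree inv)
                      (λ f f∉r → update-elsewhere c {star r} {f} a λ { refl → f∉r (star-class r) })
                      (λ p p∈r → contradiction p∈r (leaf p))
    ; all-seen = all-seen-update (all-seen inv) gap (r , update-here c (star r) a)
    }

  reply : ∀ {c e a} → Invariant c → Legal T c e a → Reply T Invariant (update T c e a)
  reply {e = e} inv legal with shape e
  ... | opposite p = reply-opp inv legal
  ... | at-v r with any? (λ p → p ↑ˡ n ≟ r)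
  ...   | yes (p , refl) = reply-vu {p = p} inv legal
  ...   | no ¬vu = reply-leaf {r = r} inv (λ p → ¬vu ∘ (p ,_)) legal

lemma66 : (n : ℕ) → LineNiceBA (tetrahedronOfFlowers n)
lemma66 n =
  3 + n ,
  (star-clique , λ _ clique → clique≤colours T clique class class-proper) ,
  (alice-wins-by-invariant T Invariant invariant-empty unstuck reply ,
   λ _ j<3+n → alice-loses-below-clique star-clique j<3+n)
  where open Tetrahedron n
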